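{- Let $S=\langle U,\iota\rangle$ be an arbitrary $3$-valued structure with $U=\{u_1,\dots,u_n\}$. Let $V_1,\dots,V_n$ be monadic second-order (set) variables and put $\mathit{node}^S_{u_i}(w):=(w\in V_i)$. Define the existential monadic second-order formula $$\eta^S:=\exists V_1,\dots,V_n.\ \bigwedge_{i=1}^n\exists w_i.\,w_i\in V_i\ \wedge\ \bigwedge_{k\neq j}\forall w_1,w_2.\,(w_1\in V_k\wedge w_2\in V_j\Rightarrow\neg eq(w_1,w_2))\ \wedge\ \forall w.\bigvee_{i=1}^n w\in V_i\ \wedge\ \bigwedge_{p\in\mathcal{P}_0}p^{\iota(p)()}\ \wedge\ \bigwedge_{r=1}^{\mathit{maxR}}\bigwedge_{p\in\mathcal{P}_r}\forall w_1,\dots,w_r.\bigwedge_{(u'_1,\dots,u'_r)\in U^r}\Big(\bigwedge_{j=1}^r\mathit{node}^S_{u'_j}(w_j)\Rightarrow p^{\iota(p)(u'_1,\dots,u'_r)}(w_1,\dots,w_r)\Big),$$ and $\widehat{\gamma}_{NP}(S):=F\wedge\eta^S$. Then for every $2$-valued structure $S^\natural$: $S^\natural\in\gamma(S)$ iff $S^\natural\models\widehat{\gamma}_{NP}(S)$.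
   Context: Fix a finite vocabulary $\mathcal{P}$ of predicate symbols containing a designated binary symbol $eq$; $\mathcal{P}_i$ denotes the symbols of arity $i$, $\mathit{maxR}$ the maximal arity. Fix a closed formula $F$ of first-order logic with transitive closure over $\mathcal{P}$ (the integrity formula). A $2$-valued structure is $\langle U,\iota\rangle$ with $\iota(p):U^i\to\{0,1\}$ for $p\in\mathcal{P}_i$, $\iota(eq)$ being equality. A $3$-valued structure has $\iota(p):U^i\to\{0,1,1/2\}$, with $\iota(eq)(u,u)\in\{1,1/2\}$ and $\iota(eq)(u_1,u_2)=0$ for distinct $u_1,u_2$. Information order: $l_1\sqsubseteq l_2$ iff $l_1=l_2$ or $l_2=1/2$. A surjective $f:U^S\to U^{S'}$ embeds $S$ into $S'$ if $\iota^S(p)(u_1,\dots,u_i)\sqsubseteq\iota^{S'}(p)(f(u_1),\dots,f(u_i))$ for all $p\in\mathcal{P}_i$ and all $u_1,\dots,u_i$. $\gamma(S)$ is the set of $2$-valued structures $S^\natural$ with $S^\natural\models F$ that embed into $S$. For a $k$-ary $p$ and $B\in\{0,1,1/2\}$: $p^0(\bar v):=\neg p(\bar v)$, $p^1(\bar v):=p(\bar v)$, $p^{1/2}(\bar v):=\mathit{true}$ (for nullary $p$ the argument list is empty). -}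

module Defs where

open import Level using (Level; Lift; lift) renaming (suc to lsuc; zero to lzero)
open import Data.Nat using (ℕ; zero; suc; _+_; _⊔_; _≟_)
open import Data.Fin using (Fin; _↑ˡ_) renaming (zero to fzero; suc to fsuc; _≟_ to _≟ᶠ_)
open import Data.Bool using (Bool; true; false)
open import Data.List using (List; []; _∷_; foldr; map; concatMap; allFin; upTo; filter)
open import Data.Vec using (Vec; []; _∷_; tabulate; lookup) renaming (map to vmap)
open import Data.Product using (Σ; _×_; _,_)
open import Data.Sum using (_⊎_)
open import Data.Unit.Polymorphic using (⊤)
open import Data.Empty.Polymorphic using (⊥)
open import Relation.Nullary using (¬_; yes; no)
open import Relation.Binary.PropositionalEquality using (_≡_; _≢_; subst; sym)
import Data.Nat.Properties
open import Relation.Binary.Construct.Closure.Transitive using (TransClosure)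
open import Function.Bundles using (_⇔_)

-- Vocabulary: a finite set of predicate symbols containing eq (binary).
-- Predicate symbols are  Fin (suc m);  fzero is the designated eq,
-- the other m symbols have arbitrary arities  ar i.

record Vocabulary : Set where
  field
    m  : ℕ
    ar : Fin m → ℕ

module _ (𝒱 : Vocabulary) where
  open Vocabulary 𝒱

  Pred : Set
  Pred = Fin (suc m)

  arity : Pred → ℕ
  arity fzero    = 2
  arity (fsuc i) = ar i

  eqP : Pred
  eqP = fzero

  allPreds : List Pred
  allPreds = allFin (suc m)

  maxR : ℕ
  maxR = foldr _⊔_ 0 (map arity allPreds)

  -- Scoped de Bruijn syntax:
  -- Formula n k has n free first-order and k free set variables.

  infixr 3 _∧'_
  infixr 2 _∨'_
  infixr 1 _⇒'_

  data Formula (n k : ℕ) : Set where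
    atom  : (p : Pred) → Vec (Fin n) (arity p) → Formula n k
    mem   : Fin n → Fin k → Formula n k
    tt ff : Formula n k
    ¬'_   : Formula n k → Formula n k
    _∧'_ _∨'_ _⇒'_ : Formula n k → Formula n k → Formula n k
    ∀' ∃' : Formula (suc n) k → Formula n k
    ∃V    : Formula n (suc k) → Formula n k
    -- (TC v₁,v₂ : φ)(a,b);  in φ, index 1 is v₁ and index 0 is v₂
    tc    : Formula (suc (suc n)) k → Fin n → Fin n → Formula n k

  data FOTC {n k : ℕ} : Formula n k → Set where
    atom : ∀ p ws → FOTC (atom p ws)
    tt   : FOTC tt
    ff   : FOTC ff
    ¬'_  : ∀ {φ} → FOTC φ → FOTC (¬' φ)
    _∧'_ : ∀ {φ ψ} → FOTC φ → FOTC ψ → FOTC (φ ∧' ψ)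
    _∨'_ : ∀ {φ ψ} → FOTC φ → FOTC ψ → FOTC (φ ∨' ψ)
    _⇒'_ : ∀ {φ ψ} → FOTC φ → FOTC ψ → FOTC (φ ⇒' ψ)
    ∀'   : ∀ {φ} → FOTC {suc n} {k} φ → FOTC (∀' φ)
    ∃'   : ∀ {φ} → FOTC {suc n} {k} φ → FOTC (∃' φ)
    tc   : ∀ {φ} a b → FOTC {suc (suc n)} {k} φ → FOTC (tc φ a b)

  ⋀ : ∀ {n k} → List (Formula n k) → Formula n k
  ⋀ = foldr _∧'_ tt

  ⋁ : ∀ {n k} → List (Formula n k) → Formula n k
  ⋁ = foldr _∨'_ ff

  ∃Vs : ∀ {n k} r → Formula n (r + k) → Formula n k
  ∃Vs zero    φ = φ
  ∃Vs (suc r) φ = ∃Vs r (∃V φ)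

  ∀s : ∀ {n k} r → Formula (r + n) k → Formula n k
  ∀s zero    φ = φ
  ∀s (suc r) φ = ∀s r (∀' φ)

  record TwoStruct : Set₁ where
    field
      U   : Set
      ι   : (p : Pred) → Vec U (arity p) → Bool
      ι-eq : ∀ (a b : U) → (ι eqP (a ∷ b ∷ []) ≡ true) ⇔ (a ≡ b)

  ext : ∀ {a} {A : Set a} {n} → A → (Fin n → A) → Fin (suc n) → A
  ext x ρ fzero    = x
  ext x ρ (fsuc i) = ρ i

  Sat : (S : TwoStruct) → ∀ {n k} → Formula n k →
        (Fin n → TwoStruct.U S) → (Fin k → (TwoStruct.U S → Set)) → Set₁
  Sat S (atom p ws) ρ σ = Lift _ (TwoStruct.ι S p (vmap ρ ws) ≡ true)
  Sat S (mem w V)   ρ σ = Lift _ (σ V (ρ w))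
  Sat S tt          ρ σ = ⊤
  Sat S ff          ρ σ = ⊥
  Sat S (¬' φ)      ρ σ = ¬ Sat S φ ρ σ
  Sat S (φ ∧' ψ)    ρ σ = Sat S φ ρ σ × Sat S ψ ρ σ
  Sat S (φ ∨' ψ)    ρ σ = Sat S φ ρ σ ⊎ Sat S ψ ρ σ
  Sat S (φ ⇒' ψ)    ρ σ = Sat S φ ρ σ → Sat S ψ ρ σ
  Sat S (∀' φ)      ρ σ = (u : TwoStruct.U S) → Sat S φ (ext u ρ) σ
  Sat S (∃' φ)      ρ σ = Σ (TwoStruct.U S) λ u → Sat S φ (ext u ρ) σ
  Sat S (∃V φ)      ρ σ = Σ (TwoStruct.U S → Set) λ X → Sat S φ ρ (ext X σ)
  Sat S (tc φ a b)  ρ σ =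
    TransClosure (λ x y → Sat S φ (ext y (ext x ρ)) σ) (ρ a) (ρ b)

  _⊨_ : TwoStruct → Formula 0 0 → Set₁
  S ⊨ φ = Sat S φ (λ ()) (λ ())

  data K3 : Set where
    k0 k1 k½ : K3

  _⊑_ : K3 → K3 → Set
  l₁ ⊑ l₂ = (l₁ ≡ l₂) ⊎ (l₂ ≡ k½)

  toK3 : Bool → K3
  toK3 false = k0
  toK3 true  = k1

  record ThreeStruct : Set where
    field
      n   : ℕ
      ι   : (p : Pred) → Vec (Fin n) (arity p) → K3
      ι-eq-diag : ∀ (u : Fin n) → (ι eqP (u ∷ u ∷ []) ≡ k1) ⊎ (ι eqP (u ∷ u ∷ []) ≡ k½)
      ι-eq-off  : ∀ (u₁ u₂ : Fin n) → u₁ ≢ u₂ → ι eqP (u₁ ∷ u₂ ∷ []) ≡ k0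

  Embeds : (S♮ : TwoStruct) (S : ThreeStruct) →
           (TwoStruct.U S♮ → Fin (ThreeStruct.n S)) → Set
  Embeds S♮ S f =
    (∀ u → Σ (TwoStruct.U S♮) λ w → f w ≡ u) ×
    (∀ (p : Pred) (ws : Vec (TwoStruct.U S♮) (arity p)) →
       toK3 (TwoStruct.ι S♮ p ws) ⊑ ThreeStruct.ι S p (vmap f ws))

  InGamma : Formula 0 0 → ThreeStruct → TwoStruct → Set₁
  InGamma F S S♮ =
    (S♮ ⊨ F) × Σ (TwoStruct.U S♮ → Fin (ThreeStruct.n S)) λ f → Lift (lsuc lzero) (Embeds S♮ S f)

  lit : ∀ {n k} → K3 → (p : Pred) → Vec (Fin n) (arity p) → Formula n k
  lit k0 p ws = ¬' atom p ws
  lit k1 p ws = atom p ws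
  lit k½ p ws = tt

  allVecs : ∀ N r → List (Vec (Fin N) r)
  allVecs N zero    = [] ∷ []
  allVecs N (suc r) = concatMap (λ u → map (u ∷_) (allVecs N r)) (allFin N)

  nullaries : List Pred → List (Σ Pred λ p → arity p ≡ 0)
  nullaries []       = []
  nullaries (p ∷ ps) with arity p ≟ 0
  ... | yes e = (p , e) ∷ nullaries ps
  ... | no  _ = nullaries ps

  predsOfArity : ℕ → List Pred
  predsOfArity r = filter (λ p → arity p ≟ r) allPreds

  module _ (S : ThreeStruct) where
    open ThreeStruct S renaming (n to N; ι to ιS)

    node : ∀ {n} → Fin N → Fin n → Formula n N
    node u w = mem w u

    part-nonempty : Formula 0 N
    part-nonempty = ⋀ (map (λ i → ∃' (mem fzero i)) (allFin N))

    pairsNeq : List (Fin N × Fin N)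
    pairsNeq = concatMap (λ k → map (λ j → (k , j))
                 (filter (λ j → Relation.Nullary.¬? (k ≟ᶠ j)) (allFin N))) (allFin N)

    -- ∀ w₁ w₂ . (w₁ ∈ V_k ∧ w₂ ∈ V_j ⇒ ¬ eq(w₁,w₂));  w₁ = index 1, w₂ = index 0
    part-disjoint : Formula 0 N
    part-disjoint = ⋀ (map (λ { (k , j) →
      ∀' (∀' ((mem (fsuc fzero) k ∧' mem fzero j) ⇒'
               (¬' atom eqP (fsuc fzero ∷ fzero ∷ [])))) }) pairsNeq)

    part-cover : Formula 0 N
    part-cover = ∀' (⋁ (map (λ i → mem fzero i) (allFin N)))

    part-nullary : Formula 0 N
    part-nullary = ⋀ (map (λ { (p , e) →
      lit (ιS p (subst (Vec (Fin N)) (sym e) [])) p (subst (Vec (Fin 0)) (sym e) []) })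
      (nullaries allPreds))

    -- ∀ w₁..w_r . ⋀_{ū ∈ U^r} (⋀_j node_{u_j}(w_j) ⇒ p^{ι(p)(ū)}(w̄)),  r = arity p,
    -- w_j is the first-order variable  j ↑ˡ 0
    clause : (p : Pred) → Formula 0 N
    clause p = ∀s (arity p) (⋀ (map (λ us →
        ⋀ (map (λ j → node (lookup us j) (j ↑ˡ 0)) (allFin (arity p)))
        ⇒' lit (ιS p us) p (tabulate (_↑ˡ 0)))
      (allVecs N (arity p))))

    part-preds : Formula 0 N
    part-preds = ⋀ (map (λ r → ⋀ (map clause (predsOfArity r))) (map suc (upTo maxR)))

    η : Formula 0 0
    η = ∃Vs N (subst (Formula 0) (sym (Data.Nat.Properties.+-identityʳ N))
          (part-nonempty ∧' part-disjoint ∧' part-cover ∧' part-nullary ∧' part-preds))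

  γ̂NP : ThreeStruct → Formula 0 0 → Formula 0 0
  γ̂NP S F = F ∧' η S

-- A valuation of the set variables V₁ … Vₙ satisfying the first three conjuncts of η^S is a
-- partition of the universe of S♮ into n nonempty blocks (disjointness is stated with eq, which
-- S♮ interprets as equality), i.e. the family of fibres of a surjection f onto the universe of S.
-- Under this correspondence node^S_u(w) says f w = u, so the predicate conjuncts say exactly
-- that each value of S♮ at w̄ is approximated by the value of S at f w̄: f embeds S♮ into S.
-- Conversely, an embedding f provides the witnesses Vᵢ := f⁻¹(uᵢ).

module Submission where

open import Defs
open import Level using (lift; lower)
open import Data.Nat using (ℕ; zero; suc; _+_; _⊔_; _≤_)
import Data.Nat as ℕ
open import Data.Nat.Properties using (m≤m⊔n; m≤n⊔m; ≤-trans; +-identityʳ; ≡-irrelevant)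
open import Data.Fin using (Fin; _↑ˡ_; toℕ; cast; zero; suc; _≟_)
open import Data.Fin.Properties using (toℕ-injective; toℕ-↑ˡ; toℕ-cast; subst-is-cast)
open import Data.Bool using (true; false)
open import Data.List using (List; []; _∷_; foldr; map; allFin; upTo; filter)
open import Data.List.Relation.Unary.Any using (here; there)
open import Data.List.Membership.Propositional using (_∈_)
open import Data.List.Membership.Propositional.Properties
  using (∈-map⁺; ∈-map⁻; ∈-concat⁺′; ∈-concat⁻′; ∈-filter⁺; ∈-filter⁻; ∈-allFin; ∈-upTo⁺)
open import Data.Vec using (Vec; []; _∷_; tabulate; lookup) renaming (map to vmap)
open import Data.Vec.Properties using (tabulate∘lookup; tabulate-cong; tabulate-∘; lookup-map)
open import Data.Product using (Σ; _×_; _,_; proj₁; proj₂)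
import Data.Product as Product
open import Data.Sum using (inj₁; inj₂)
open import Data.Empty using (⊥-elim)
open import Relation.Nullary using (¬?; yes; no)
open import Relation.Binary.PropositionalEquality
  using (_≡_; _≢_; refl; sym; trans; cong; subst; subst₂; module ≡-Reasoning)
open import Function.Base using (id; _∘_)
open import Function.Bundles using (_⇔_; mk⇔; Equivalence)

open Equivalence using (to; from)
open ≡-Reasoning

∈⇒≤foldr⊔ : ∀ {x} xs → x ∈ xs → x ≤ foldr _⊔_ 0 xs
∈⇒≤foldr⊔ (y ∷ xs) (here refl) = m≤m⊔n y _
∈⇒≤foldr⊔ (y ∷ xs) (there x∈xs) = ≤-trans (∈⇒≤foldr⊔ xs x∈xs) (m≤n⊔m y _)

Vec-length0-unique : ∀ {X : Set} {a} → a ≡ 0 → (v w : Vec X a) → v ≡ w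
Vec-length0-unique refl [] [] = refl

subst-Fin-↑ˡ0 : ∀ {N} (e : N ≡ N + 0) (i : Fin N) → subst Fin e i ≡ i ↑ˡ 0
subst-Fin-↑ˡ0 e i = toℕ-injective (begin
  toℕ (subst Fin e i)  ≡⟨ cong toℕ (subst-is-cast e i) ⟩
  toℕ (cast e i)       ≡⟨ toℕ-cast e i ⟩
  toℕ i                ≡⟨ toℕ-↑ˡ i 0 ⟨
  toℕ (i ↑ˡ 0)         ∎)

map-tabulate≡ : ∀ {A B : Set} {r} (f : A → B) (ws : Fin r → A) (us : Vec B r) →
                (∀ j → f (ws j) ≡ lookup us j) → vmap f (tabulate ws) ≡ us
map-tabulate≡ f ws us f∘ws≗us = begin
  vmap f (tabulate ws)  ≡⟨ tabulate-∘ f ws ⟨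
  tabulate (f ∘ ws)     ≡⟨ tabulate-cong f∘ws≗us ⟩
  tabulate (lookup us)  ≡⟨ tabulate∘lookup us ⟩
  us                    ∎

module _ {𝒱 : Vocabulary} where

  exts : ∀ {a} {A : Set a} r {k} → (Fin r → A) → (Fin k → A) → Fin (r + k) → A
  exts zero    xs σ = σ
  exts (suc r) xs σ = ext 𝒱 (xs zero) (exts r (λ i → xs (suc i)) σ)

  exts-↑ˡ : ∀ {a} {A : Set a} r {k} (xs : Fin r → A) (σ : Fin k → A) i → exts r xs σ (i ↑ˡ k) ≡ xs i
  exts-↑ˡ (suc r) xs σ zero    = refl
  exts-↑ˡ (suc r) xs σ (suc i) = exts-↑ˡ r (λ i → xs (suc i)) σ i

  map-exts-tabulate-↑ˡ : ∀ {a} {A : Set a} r {k} (xs : Fin r → A) (σ : Fin k → A) →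
                         vmap (exts r xs σ) (tabulate (_↑ˡ k)) ≡ tabulate xs
  map-exts-tabulate-↑ˡ r xs σ =
    trans (sym (tabulate-∘ (exts r xs σ) (_↑ˡ _))) (tabulate-cong (exts-↑ˡ r xs σ))

  ∈-allVecs : ∀ N r (v : Vec (Fin N) r) → v ∈ allVecs 𝒱 N r
  ∈-allVecs N zero    []      = here refl
  ∈-allVecs N (suc r) (u ∷ v) =
    ∈-concat⁺′ (∈-map⁺ (u ∷_) (∈-allVecs N r v))
               (∈-map⁺ (λ u → map (u ∷_) (allVecs 𝒱 N r)) (∈-allFin u))

  ∈-nullaries : ∀ {p ps} → p ∈ ps → (e : arity 𝒱 p ≡ 0) → (p , e) ∈ nullaries 𝒱 ps
  ∈-nullaries {p} {q ∷ ps} p∈ e with arity 𝒱 q ℕ.≟ 0 | p∈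
  ... | yes e′  | here refl  = here (cong (p ,_) (≡-irrelevant e e′))
  ... | no  q≢0 | here refl  = ⊥-elim (q≢0 e)
  ... | yes _   | there p∈ps = there (∈-nullaries p∈ps e)
  ... | no  _   | there p∈ps = ∈-nullaries p∈ps e

  ∈-predsOfArity : ∀ {p r} → arity 𝒱 p ≡ r → p ∈ predsOfArity 𝒱 r
  ∈-predsOfArity {p} {r} e = ∈-filter⁺ (λ q → arity 𝒱 q ℕ.≟ r) (∈-allFin p) e

  arity≤maxR : ∀ p → arity 𝒱 p ≤ maxR 𝒱
  arity≤maxR p = ∈⇒≤foldr⊔ _ (∈-map⁺ (arity 𝒱) (∈-allFin p))

  module _ (S : ThreeStruct 𝒱) where
    private
      N = ThreeStruct.n S
      row : Fin N → List (Fin N × Fin N)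
      row k = map (k ,_) (filter (λ j → ¬? (k ≟ j)) (allFin N))

    ∈-pairsNeq⁺ : ∀ {k j} → k ≢ j → (k , j) ∈ pairsNeq 𝒱 S
    ∈-pairsNeq⁺ {k} {j} k≢j =
      ∈-concat⁺′ (∈-map⁺ (k ,_) (∈-filter⁺ (λ j → ¬? (k ≟ j)) (∈-allFin j) k≢j))
                 (∈-map⁺ row (∈-allFin k))

    ∈-pairsNeq⁻ : ∀ {k j} → (k , j) ∈ pairsNeq 𝒱 S → k ≢ j
    ∈-pairsNeq⁻ kj∈
      with _ , kj∈row , row∈ ← ∈-concat⁻′ (map row (allFin N)) kj∈
      with k , _ , refl ← ∈-map⁻ row row∈
      with _ , j∈ , refl ← ∈-map⁻ (k ,_) kj∈row
      = proj₂ (∈-filter⁻ (λ j → ¬? (k ≟ j)) {xs = allFin N} j∈)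

  module _ (S♮ : TwoStruct 𝒱) where
    open TwoStruct S♮ using (U) renaming (ι to ι♮; ι-eq to ι♮-eq)

    sat-⋀⁺ : ∀ {A : Set} {n k} (g : A → Formula 𝒱 n k) xs {ρ σ} →
             (∀ {x} → x ∈ xs → Sat 𝒱 S♮ (g x) ρ σ) → Sat 𝒱 S♮ (⋀ 𝒱 (map g xs)) ρ σ
    sat-⋀⁺ g []       h = _
    sat-⋀⁺ g (x ∷ xs) h = h (here refl) , sat-⋀⁺ g xs (λ x∈xs → h (there x∈xs))

    sat-⋀⁻ : ∀ {A : Set} {n k} (g : A → Formula 𝒱 n k) xs {ρ σ} →
             Sat 𝒱 S♮ (⋀ 𝒱 (map g xs)) ρ σ → ∀ {x} → x ∈ xs → Sat 𝒱 S♮ (g x) ρ σ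
    sat-⋀⁻ g (y ∷ xs) (h , _) (here refl)  = h
    sat-⋀⁻ g (y ∷ xs) (_ , h) (there x∈xs) = sat-⋀⁻ g xs h x∈xs

    sat-⋁⁺ : ∀ {A : Set} {n k} (g : A → Formula 𝒱 n k) xs {ρ σ x} →
             x ∈ xs → Sat 𝒱 S♮ (g x) ρ σ → Sat 𝒱 S♮ (⋁ 𝒱 (map g xs)) ρ σ
    sat-⋁⁺ g (y ∷ xs) (here refl)  h = inj₁ h
    sat-⋁⁺ g (y ∷ xs) (there x∈xs) h = inj₂ (sat-⋁⁺ g xs x∈xs h)

    sat-⋁⁻ : ∀ {A : Set} {n k} (g : A → Formula 𝒱 n k) xs {ρ σ} →
             Sat 𝒱 S♮ (⋁ 𝒱 (map g xs)) ρ σ → Σ A λ x → Sat 𝒱 S♮ (g x) ρ σ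
    sat-⋁⁻ g (y ∷ xs) (inj₁ h) = y , h
    sat-⋁⁻ g (y ∷ xs) (inj₂ h) = sat-⋁⁻ g xs h

    sat-∃Vs⁺ : ∀ r {n k} (φ : Formula 𝒱 n (r + k)) {ρ σ} (Xs : Fin r → U → Set) →
               Sat 𝒱 S♮ φ ρ (exts r Xs σ) → Sat 𝒱 S♮ (∃Vs 𝒱 r φ) ρ σ
    sat-∃Vs⁺ zero    φ Xs h = h
    sat-∃Vs⁺ (suc r) φ Xs h = sat-∃Vs⁺ r (∃V φ) (λ i → Xs (suc i)) (Xs zero , h)

    sat-∃Vs⁻ : ∀ r {n k} (φ : Formula 𝒱 n (r + k)) {ρ σ} →
               Sat 𝒱 S♮ (∃Vs 𝒱 r φ) ρ σ → Σ (Fin r → U → Set) λ Xs → Sat 𝒱 S♮ φ ρ (exts r Xs σ)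
    sat-∃Vs⁻ zero    φ h = (λ ()) , h
    sat-∃Vs⁻ (suc r) φ h with Xs , (X , h′) ← sat-∃Vs⁻ r (∃V φ) h = ext 𝒱 X Xs , h′

    sat-∀s⁺ : ∀ r {n k} (φ : Formula 𝒱 (r + n) k) {ρ σ} →
              (∀ (ws : Fin r → U) → Sat 𝒱 S♮ φ (exts r ws ρ) σ) → Sat 𝒱 S♮ (∀s 𝒱 r φ) ρ σ
    sat-∀s⁺ zero    φ h = h (λ ())
    sat-∀s⁺ (suc r) φ h = sat-∀s⁺ r (∀' φ) (λ ws u → h (ext 𝒱 u ws))

    sat-∀s⁻ : ∀ r {n k} (φ : Formula 𝒱 (r + n) k) {ρ σ} →
              Sat 𝒱 S♮ (∀s 𝒱 r φ) ρ σ → ∀ (ws : Fin r → U) → Sat 𝒱 S♮ φ (exts r ws ρ) σ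
    sat-∀s⁻ zero    φ h ws = h
    sat-∀s⁻ (suc r) φ h ws = sat-∀s⁻ r (∀' φ) h (λ i → ws (suc i)) (ws zero)

    sat-subst⁺ : ∀ {n a b} (e : a ≡ b) (φ : Formula 𝒱 n a) {ρ σ} →
                 Sat 𝒱 S♮ φ ρ (λ i → σ (subst Fin e i)) → Sat 𝒱 S♮ (subst (Formula 𝒱 n) e φ) ρ σ
    sat-subst⁺ refl φ h = h

    sat-subst⁻ : ∀ {n a b} (e : a ≡ b) (φ : Formula 𝒱 n a) {ρ σ} →
                 Sat 𝒱 S♮ (subst (Formula 𝒱 n) e φ) ρ σ → Sat 𝒱 S♮ φ ρ (λ i → σ (subst Fin e i))
    sat-subst⁻ refl φ h = h

    sat-lit⁺ : ∀ {n k} b p (vs : Vec (Fin n) (arity 𝒱 p)) {ρ} {σ : Fin k → U → Set} →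
               _⊑_ 𝒱 (toK3 𝒱 (ι♮ p (vmap ρ vs))) b → Sat 𝒱 S♮ (lit 𝒱 b p vs) ρ σ
    sat-lit⁺ k0 p vs {ρ} h with ι♮ p (vmap ρ vs) | h
    ... | false | _      = λ ()
    ... | true  | inj₁ ()
    ... | true  | inj₂ ()
    sat-lit⁺ k1 p vs {ρ} h with ι♮ p (vmap ρ vs) | h
    ... | true  | _      = lift refl
    ... | false | inj₁ ()
    ... | false | inj₂ ()
    sat-lit⁺ k½ p vs h = _

    sat-lit⁻ : ∀ {n k} b p (vs : Vec (Fin n) (arity 𝒱 p)) {ρ} {σ : Fin k → U → Set} →
               Sat 𝒱 S♮ (lit 𝒱 b p vs) ρ σ → _⊑_ 𝒱 (toK3 𝒱 (ι♮ p (vmap ρ vs))) b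
    sat-lit⁻ k0 p vs {ρ} h with ι♮ p (vmap ρ vs)
    ... | false = inj₁ refl
    ... | true  = ⊥-elim (h (lift refl))
    sat-lit⁻ k1 p vs (lift h) rewrite h = inj₁ refl
    sat-lit⁻ k½ p vs h = inj₂ refl

    module _ (S : ThreeStruct 𝒱) where
      open ThreeStruct S using () renaming (n to N; ι to ιS)

      Fibres : (U → Fin N) → (Fin N → U → Set) → Set
      Fibres f τ = ∀ i w → τ i w ⇔ f w ≡ i

      EmbedsAt : (U → Fin N) → Pred 𝒱 → Set
      EmbedsAt f p = ∀ ws → _⊑_ 𝒱 (toK3 𝒱 (ι♮ p ws)) (ιS p (vmap f ws))

      nodes : ∀ {r} → Vec (Fin N) r → Formula 𝒱 (r + 0) N
      nodes {r} us = ⋀ 𝒱 (map (λ j → node 𝒱 S (lookup us j) (j ↑ˡ 0)) (allFin r))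

      η-body : Formula 𝒱 0 N
      η-body = part-nonempty 𝒱 S ∧' part-disjoint 𝒱 S ∧' part-cover 𝒱 S
            ∧' part-nullary 𝒱 S ∧' part-preds 𝒱 S

      clauses-of-arity : ℕ → Formula 𝒱 0 N
      clauses-of-arity r = ⋀ 𝒱 (map (clause 𝒱 S) (predsOfArity 𝒱 r))

      module _ {ρ : Fin 0 → U} {τ : Fin N → U → Set} where

        fibres-of-partition : Sat 𝒱 S♮ (part-cover 𝒱 S) ρ τ → Sat 𝒱 S♮ (part-disjoint 𝒱 S) ρ τ →
                              Σ (U → Fin N) λ f → Fibres f τ
        fibres-of-partition cover disjoint = f , λ i w → mk⇔ (unique w i) λ { refl → in-f w }
          where
          pick : ∀ w → Σ (Fin N) λ i → Sat 𝒱 S♮ (mem zero i) (ext 𝒱 w ρ) τ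
          pick w = sat-⋁⁻ (λ i → mem zero i) (allFin N) (cover w)
          f : U → Fin N
          f w = proj₁ (pick w)
          in-f : ∀ w → τ (f w) w
          in-f w = lower (proj₂ (pick w))
          unique : ∀ w i → τ i w → f w ≡ i
          unique w i τiw with f w ≟ i
          ... | yes fw≡i = fw≡i
          ... | no  fw≢i = ⊥-elim (sat-⋀⁻ _ (pairsNeq 𝒱 S) disjoint (∈-pairsNeq⁺ S fw≢i) w w
                                     (lift (in-f w) , lift τiw) (lift (from (ι♮-eq w w) refl)))

        module _ {f : U → Fin N} (fib : Fibres f τ) where

          fibres⇒sat-cover : Sat 𝒱 S♮ (part-cover 𝒱 S) ρ τ
          fibres⇒sat-cover w =
            sat-⋁⁺ (λ i → mem zero i) (allFin N) (∈-allFin (f w)) (lift (from (fib (f w) w) refl))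

          fibres⇒sat-disjoint : Sat 𝒱 S♮ (part-disjoint 𝒱 S) ρ τ
          fibres⇒sat-disjoint = sat-⋀⁺ _ (pairsNeq 𝒱 S)
            λ { {k , j} kj∈ w₁ w₂ (lift τkw₁ , lift τjw₂) (lift w₁≈w₂) →
                ∈-pairsNeq⁻ S kj∈ (begin
                  k     ≡⟨ sym (to (fib k w₁) τkw₁) ⟩
                  f w₁  ≡⟨ cong f (to (ι♮-eq w₁ w₂) w₁≈w₂) ⟩
                  f w₂  ≡⟨ to (fib j w₂) τjw₂ ⟩
                  j     ∎) }

          surjective⇒sat-nonempty : (∀ i → Σ U λ w → f w ≡ i) → Sat 𝒱 S♮ (part-nonempty 𝒱 S) ρ τ
          surjective⇒sat-nonempty surj =
            sat-⋀⁺ _ (allFin N) λ {i} _ → proj₁ (surj i) , lift (from (fib i _) (proj₂ (surj i)))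

          sat-nonempty⇒surjective : Sat 𝒱 S♮ (part-nonempty 𝒱 S) ρ τ → ∀ i → Σ U λ w → f w ≡ i
          sat-nonempty⇒surjective h i with w , lift τiw ← sat-⋀⁻ _ (allFin N) h (∈-allFin i) =
            w , to (fib i w) τiw

          sat-nodes⁺ : ∀ {r} {us : Vec (Fin N) r} (ws : Fin r → U) →
                       (∀ j → f (ws j) ≡ lookup us j) → Sat 𝒱 S♮ (nodes us) (exts r ws ρ) τ
          sat-nodes⁺ {r} ws f∘ws≗us = sat-⋀⁺ _ (allFin r)
            λ {j} _ → lift (subst (τ _) (sym (exts-↑ˡ r ws ρ j)) (from (fib _ _) (f∘ws≗us j)))

          sat-nodes⁻ : ∀ {r} {us : Vec (Fin N) r} (ws : Fin r → U) →
                       Sat 𝒱 S♮ (nodes us) (exts r ws ρ) τ → ∀ j → f (ws j) ≡ lookup us j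
          sat-nodes⁻ {r} ws h j =
            to (fib _ _) (subst (τ _) (exts-↑ˡ r ws ρ j) (lower (sat-⋀⁻ _ (allFin r) h (∈-allFin j))))

          sat-clause⇒embedsAt : ∀ {p} → Sat 𝒱 S♮ (clause 𝒱 S p) ρ τ → EmbedsAt f p
          sat-clause⇒embedsAt {p} h ws =
            subst (λ v → _⊑_ 𝒱 (toK3 𝒱 (ι♮ p v)) (ιS p (vmap f ws))) ws-recovered
              (sat-lit⁻ (ιS p (vmap f ws)) p (tabulate (_↑ˡ 0))
                 (clause-at-ws (sat-nodes⁺ {us = vmap f ws} (lookup ws) (λ j → sym (lookup-map j f ws)))))
            where
            r = arity 𝒱 p
            clause-at-ws : Sat 𝒱 S♮ (nodes (vmap f ws) ⇒' lit 𝒱 (ιS p (vmap f ws)) p (tabulate (_↑ˡ 0)))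
                               (exts r (lookup ws) ρ) τ
            clause-at-ws =
              sat-⋀⁻ _ (allVecs 𝒱 N r) (sat-∀s⁻ r _ h (lookup ws)) (∈-allVecs N r (vmap f ws))
            ws-recovered : vmap (exts r (lookup ws) ρ) (tabulate (_↑ˡ 0)) ≡ ws
            ws-recovered = trans (map-exts-tabulate-↑ˡ r (lookup ws) ρ) (tabulate∘lookup ws)

          embedsAt⇒sat-clause : ∀ {p} → EmbedsAt f p → Sat 𝒱 S♮ (clause 𝒱 S p) ρ τ
          embedsAt⇒sat-clause {p} emb = sat-∀s⁺ r _ λ ws → sat-⋀⁺ _ (allVecs 𝒱 N r) λ {us} _ premise →
            sat-lit⁺ _ p _ (subst₂ (λ v v′ → _⊑_ 𝒱 (toK3 𝒱 (ι♮ p v)) (ιS p v′))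
                                   (sym (map-exts-tabulate-↑ˡ r ws ρ))
                                   (map-tabulate≡ f ws us (sat-nodes⁻ {us = us} ws premise))
                                   (emb (tabulate ws)))
            where r = arity 𝒱 p

        sat-nullary⇒embedsAt : ∀ {f p} → Sat 𝒱 S♮ (part-nullary 𝒱 S) ρ τ → arity 𝒱 p ≡ 0 → EmbedsAt f p
        sat-nullary⇒embedsAt {f} {p} h e ws =
          subst₂ (λ v v′ → _⊑_ 𝒱 (toK3 𝒱 (ι♮ p v)) (ιS p v′))
                 (Vec-length0-unique e _ ws) (Vec-length0-unique e _ (vmap f ws))
                 (sat-lit⁻ _ p _ (sat-⋀⁻ _ (nullaries 𝒱 (allPreds 𝒱)) h (∈-nullaries (∈-allFin p) e)))

        embeds⇒sat-nullary : ∀ {f} → (∀ p → EmbedsAt f p) → Sat 𝒱 S♮ (part-nullary 𝒱 S) ρ τ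
        embeds⇒sat-nullary {f} emb = sat-⋀⁺ _ (nullaries 𝒱 (allPreds 𝒱))
          λ { {p , e} _ → sat-lit⁺ _ p _
                (subst (λ v → _⊑_ 𝒱 (toK3 𝒱 (ι♮ p _)) (ιS p v)) (Vec-length0-unique e _ _) (emb p _)) }

        sat-preds⇒sat-clause : Sat 𝒱 S♮ (part-preds 𝒱 S) ρ τ → ∀ p {r} → arity 𝒱 p ≡ suc r →
                               Sat 𝒱 S♮ (clause 𝒱 S p) ρ τ
        sat-preds⇒sat-clause h p {r} e =
          sat-⋀⁻ (clause 𝒱 S) (predsOfArity 𝒱 (suc r))
            (sat-⋀⁻ clauses-of-arity (map suc (upTo (maxR 𝒱))) h
               (∈-map⁺ suc (∈-upTo⁺ (subst (_≤ maxR 𝒱) e (arity≤maxR p)))))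
            (∈-predsOfArity {p} e)

        clauses⇒sat-preds : (∀ p → Sat 𝒱 S♮ (clause 𝒱 S p) ρ τ) → Sat 𝒱 S♮ (part-preds 𝒱 S) ρ τ
        clauses⇒sat-preds h = sat-⋀⁺ clauses-of-arity (map suc (upTo (maxR 𝒱)))
          λ {r} _ → sat-⋀⁺ (clause 𝒱 S) (predsOfArity 𝒱 r) λ {p} _ → h p

        sat-η-body⇒embeds : Sat 𝒱 S♮ η-body ρ τ → Σ (U → Fin N) (Embeds 𝒱 S♮ S)
        sat-η-body⇒embeds (nonempty , disjoint , cover , nullary , preds)
          with f , fib ← fibres-of-partition cover disjoint
          = f , sat-nonempty⇒surjective fib nonempty , embedsAt
          where
          embedsAt-of-arity : ∀ p a → arity 𝒱 p ≡ a → EmbedsAt f p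
          embedsAt-of-arity p zero    e = sat-nullary⇒embedsAt nullary e
          embedsAt-of-arity p (suc r) e = sat-clause⇒embedsAt fib (sat-preds⇒sat-clause preds p e)
          embedsAt : ∀ p → EmbedsAt f p
          embedsAt p = embedsAt-of-arity p (arity 𝒱 p) refl

        embeds⇒sat-η-body : ∀ {f} → Embeds 𝒱 S♮ S f → Fibres f τ → Sat 𝒱 S♮ η-body ρ τ
        embeds⇒sat-η-body (surj , emb) fib =
          surjective⇒sat-nonempty fib surj , fibres⇒sat-disjoint fib , fibres⇒sat-cover fib ,
          embeds⇒sat-nullary emb , clauses⇒sat-preds (λ p → embedsAt⇒sat-clause fib (emb p))

      sat-η⇒embeds : _⊨_ 𝒱 S♮ (η 𝒱 S) → Σ (U → Fin N) (Embeds 𝒱 S♮ S)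
      sat-η⇒embeds h with _ , h′ ← sat-∃Vs⁻ N _ h =
        sat-η-body⇒embeds (sat-subst⁻ (sym (+-identityʳ N)) η-body h′)

      embeds⇒sat-η : ∀ {f} → Embeds 𝒱 S♮ S f → _⊨_ 𝒱 S♮ (η 𝒱 S)
      embeds⇒sat-η {f} emb =
        sat-∃Vs⁺ N _ fibre (sat-subst⁺ (sym (+-identityʳ N)) η-body (embeds⇒sat-η-body emb fibres))
        where
        fibre : Fin N → U → Set
        fibre i w = f w ≡ i
        fibres : ∀ {σ} → Fibres f (λ i → exts N fibre σ (subst Fin (sym (+-identityʳ N)) i))
        fibres {σ} i w rewrite subst-Fin-↑ˡ0 (sym (+-identityʳ N)) i | exts-↑ˡ N fibre σ i = mk⇔ id id

-- The integrity formula F occurs unchanged on both sides.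
theorem3 : (𝒱 : Vocabulary) (F : Formula 𝒱 0 0) → FOTC 𝒱 F →
           (S : ThreeStruct 𝒱) (S♮ : TwoStruct 𝒱) →
           InGamma 𝒱 F S S♮ ⇔ _⊨_ 𝒱 S♮ (γ̂NP 𝒱 S F)
theorem3 𝒱 F _ S S♮ = mk⇔
  (λ (⊨F , _ , lift emb) → ⊨F , embeds⇒sat-η S♮ S emb)
  (λ (⊨F , ⊨η) → ⊨F , Product.map₂ lift (sat-η⇒embeds S♮ S ⊨η))
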